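{- Let $N$ be a nonzero rational number and let $(X,Y)$ and $(Z,W)$ be rational points on $C_N: y^2=x^3-N^2x$ with $Y\neq 0$ and $W\neq 0$, such that $XZ$ is the square of a rational number. Then both $$\Big(-\frac{N^2}{X}\Big)\cdot\Big(-\frac{N^2}{Z}\Big)\quad\text{and}\quad \frac{N(X+N)}{X-N}\cdot\frac{N(Z+N)}{Z-N}$$ are squares of rational numbers.
   Context: The points $\big(-\frac{N^2}{X},-\frac{N^2Y}{X^2}\big)$ and $\big(\frac{N(X+N)}{X-N},\frac{2N^2Y}{(X-N)^2}\big)$ are the (first and second) reflected points of $(X,Y)$, obtained as the third intersection of $C_N$ with the line through $(X,Y)$ and $(0,0)$, respectively $(N,0)$. -}

module Defs where

open import Data.Rational using (ℚ; 0ℚ; _*_; _+_; _-_; -_; 1/_; ≢-nonZero)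
open import Data.Rational.Properties using (_≟_)
open import Data.Product using (∃)
open import Relation.Binary.PropositionalEquality using (_≡_)
open import Relation.Nullary using (yes; no)

-- Total reciprocal: 1/p for p ≠ 0, and 0 at p = 0 (never used at 0 below,
-- since Y ≠ 0 forces X ≠ 0 and X ≠ ±N).
inv : ℚ → ℚ
inv p with p ≟ 0ℚ
... | yes _ = 0ℚ
... | no p≢0 = 1/_ p {{≢-nonZero p≢0}}

_÷'_ : ℚ → ℚ → ℚ
p ÷' q = p * inv q

OnCurve : ℚ → ℚ → ℚ → Set
OnCurve N x y = y * y ≡ x * x * x - N * N * x

IsSquare : ℚ → Set
IsSquare q = ∃ λ r → r * r ≡ q

refl₁x : ℚ → ℚ → ℚ
refl₁x N x = - ((N * N) ÷' x)

refl₂x : ℚ → ℚ → ℚ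
refl₂x N x = (N * (x + N)) ÷' (x - N)

{-# OPTIONS --safe #-}
module Submission where

-- The first product is N⁴ / (XZ), a square times the reciprocal of a square. For the second,
-- y² = x (x − N) (x + N) on the curve turns N (x + N) / (x − N) into N x · (y / (x (x − N)))²,
-- so the product is XZ times the square of N · y / (x (x − N)) · w / (z (z − N)).

open import Defs
open import Data.Rational using (ℚ; 0ℚ; 1ℚ; _*_; _+_; _-_; -_; ≢-nonZero)
open import Data.Rational.Properties
  using (_≟_; *-inverseʳ; *-identityˡ; *-identityʳ; *-zeroˡ; *-zeroʳ; *-assoc; *-comm)
open import Data.Rational.Solver using (module +-*-Solver)
open import Data.Product using (_×_; _,_)
open import Data.Empty using (⊥-elim)
open import Relation.Nullary using (Dec; yes; no)
open import Relation.Binary.PropositionalEquality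
open +-*-Solver
open ≡-Reasoning

*-inv≡1 : ∀ {p} → p ≢ 0ℚ → p * inv p ≡ 1ℚ
*-inv≡1 {p} p≢0 with p ≟ 0ℚ
... | yes p≡0 = ⊥-elim (p≢0 p≡0)
... | no  p≢0′ = *-inverseʳ p {{≢-nonZero p≢0′}}

*-≢0 : ∀ {p q} → p ≢ 0ℚ → q ≢ 0ℚ → p * q ≢ 0ℚ
*-≢0 {p} {q} p≢0 q≢0 pq≡0 = q≢0 (begin
  q                 ≡⟨ sym (*-identityˡ q) ⟩
  1ℚ * q            ≡⟨ cong (_* q) (sym (trans (*-comm (inv p) p) (*-inv≡1 p≢0))) ⟩
  (inv p * p) * q   ≡⟨ *-assoc (inv p) p q ⟩
  inv p * (p * q)   ≡⟨ cong (inv p *_) pq≡0 ⟩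
  inv p * 0ℚ        ≡⟨ *-zeroʳ (inv p) ⟩
  0ℚ                ∎)

*-≢0⇒≢0ˡ : ∀ {p q} → p * q ≢ 0ℚ → p ≢ 0ℚ
*-≢0⇒≢0ˡ {p} {q} pq≢0 p≡0 = pq≢0 (trans (cong (_* q) p≡0) (*-zeroˡ q))

*-≢0⇒≢0ʳ : ∀ {p q} → p * q ≢ 0ℚ → q ≢ 0ℚ
*-≢0⇒≢0ʳ {p} {q} pq≢0 = *-≢0⇒≢0ˡ (λ qp≡0 → pq≢0 (trans (*-comm p q) qp≡0))

inv-unique : ∀ {p q} → p ≢ 0ℚ → p * q ≡ 1ℚ → inv p ≡ q
inv-unique {p} {q} p≢0 pq≡1 = begin
  inv p             ≡⟨ sym (*-identityʳ (inv p)) ⟩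
  inv p * 1ℚ        ≡⟨ cong (inv p *_) (sym pq≡1) ⟩
  inv p * (p * q)   ≡⟨ sym (*-assoc (inv p) p q) ⟩
  (inv p * p) * q   ≡⟨ cong (_* q) (trans (*-comm (inv p) p) (*-inv≡1 p≢0)) ⟩
  1ℚ * q            ≡⟨ *-identityˡ q ⟩
  q                 ∎

-- Holds without side conditions because inv 0ℚ = 0ℚ.
inv-* : ∀ p q → inv (p * q) ≡ inv p * inv q
inv-* p q = by-cases (p ≟ 0ℚ) (q ≟ 0ℚ)
  where
  by-cases : Dec (p ≡ 0ℚ) → Dec (q ≡ 0ℚ) → inv (p * q) ≡ inv p * inv q
  by-cases (yes p≡0) _ = begin
    inv (p * q)      ≡⟨ cong (λ t → inv (t * q)) p≡0 ⟩
    inv (0ℚ * q)     ≡⟨ cong inv (*-zeroˡ q) ⟩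
    0ℚ               ≡⟨ sym (*-zeroˡ (inv q)) ⟩
    inv 0ℚ * inv q   ≡⟨ cong (λ t → inv t * inv q) (sym p≡0) ⟩
    inv p * inv q    ∎
  by-cases (no _) (yes q≡0) = begin
    inv (p * q)      ≡⟨ cong (λ t → inv (p * t)) q≡0 ⟩
    inv (p * 0ℚ)     ≡⟨ cong inv (*-zeroʳ p) ⟩
    0ℚ               ≡⟨ sym (*-zeroʳ (inv p)) ⟩
    inv p * inv 0ℚ   ≡⟨ cong (λ t → inv p * inv t) (sym q≡0) ⟩
    inv p * inv q    ∎
  by-cases (no p≢0) (no q≢0) = inv-unique (*-≢0 p≢0 q≢0) (begin
    (p * q) * (inv p * inv q)   ≡⟨ solve 4 (λ p q a b → (p :* q) :* (a :* b) := (p :* a) :* (q :* b)) refl p q (inv p) (inv q) ⟩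
    (p * inv p) * (q * inv q)   ≡⟨ cong₂ _*_ (*-inv≡1 p≢0) (*-inv≡1 q≢0) ⟩
    1ℚ                          ∎)

isSquare-square : ∀ r → IsSquare (r * r)
isSquare-square r = r , refl

isSquare-* : ∀ {p q} → IsSquare p → IsSquare q → IsSquare (p * q)
isSquare-* {p} {q} (r , r²≡p) (s , s²≡q) = r * s , (begin
  (r * s) * (r * s)   ≡⟨ solve 2 (λ r s → (r :* s) :* (r :* s) := (r :* r) :* (s :* s)) refl r s ⟩
  (r * r) * (s * s)   ≡⟨ cong₂ _*_ r²≡p s²≡q ⟩
  p * q               ∎)

isSquare-inv : ∀ {p} → IsSquare p → IsSquare (inv p)
isSquare-inv {p} (r , r²≡p) = inv r , trans (sym (inv-* r r)) (cong inv r²≡p)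

onCurve-factor : ∀ N x y → OnCurve N x y → y * y ≡ x * (x - N) * (x + N)
onCurve-factor N x y on = trans on
  (solve 2 (λ N x → x :* x :* x :- N :* N :* x := x :* (x :- N) :* (x :+ N)) refl N x)

module _ (N x y : ℚ) (on : OnCurve N x y) (y≢0 : y ≢ 0ℚ) where

  private
    x[x-N]≢0 : x * (x - N) ≢ 0ℚ
    x[x-N]≢0 = *-≢0⇒≢0ˡ {q = x + N} (subst (_≢ 0ℚ) (onCurve-factor N x y on) (*-≢0 y≢0 y≢0))

  onCurve⇒x≢0 : x ≢ 0ℚ
  onCurve⇒x≢0 = *-≢0⇒≢0ˡ {q = x - N} x[x-N]≢0

  onCurve⇒x-N≢0 : x - N ≢ 0ℚ
  onCurve⇒x-N≢0 = *-≢0⇒≢0ʳ {p = x} x[x-N]≢0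

  refl₂x≡N*x*square : refl₂x N x ≡ N * x * ((y * inv x * inv (x - N)) * (y * inv x * inv (x - N)))
  refl₂x≡N*x*square = sym (begin
    N * x * ((y * a * b) * (y * a * b))
      ≡⟨ solve 5 (λ N x y a b → N :* x :* ((y :* a :* b) :* (y :* a :* b))
                             := N :* (y :* y) :* x :* a :* a :* b :* b) refl N x y a b ⟩
    N * (y * y) * x * a * a * b * b
      ≡⟨ cong (λ t → N * t * x * a * a * b * b) (onCurve-factor N x y on) ⟩
    N * (x * (x - N) * (x + N)) * x * a * a * b * b
      ≡⟨ solve 4 (λ N x a b → N :* (x :* (x :- N) :* (x :+ N)) :* x :* a :* a :* b :* b
                           := N :* (x :+ N) :* b :* (x :* a) :* (x :* a) :* ((x :- N) :* b)) refl N x a b ⟩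
    N * (x + N) * b * (x * a) * (x * a) * ((x - N) * b)
      ≡⟨ cong₂ (λ s t → N * (x + N) * b * s * s * t) (*-inv≡1 onCurve⇒x≢0) (*-inv≡1 onCurve⇒x-N≢0) ⟩
    N * (x + N) * b * 1ℚ * 1ℚ * 1ℚ
      ≡⟨ solve 3 (λ N x b → N :* (x :+ N) :* b :* con 1ℚ :* con 1ℚ :* con 1ℚ := N :* (x :+ N) :* b) refl N x b ⟩
    N * (x + N) * b
      ∎)
    where
    a = inv x
    b = inv (x - N)

refl₁x-*-isSquare : ∀ N x z → IsSquare (x * z) → IsSquare (refl₁x N x * refl₁x N z)
refl₁x-*-isSquare N x z xz-square =
  subst IsSquare regroup (isSquare-* (isSquare-square (N * N)) (isSquare-inv xz-square))
  where
  regroup : (N * N) * (N * N) * inv (x * z) ≡ refl₁x N x * refl₁x N z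
  regroup = begin
    (N * N) * (N * N) * inv (x * z)      ≡⟨ cong ((N * N) * (N * N) *_) (inv-* x z) ⟩
    (N * N) * (N * N) * (inv x * inv z)  ≡⟨ solve 3 (λ N a b → (N :* N) :* (N :* N) :* (a :* b)
                                                         := (:- (N :* N :* a)) :* (:- (N :* N :* b))) refl N (inv x) (inv z) ⟩
    refl₁x N x * refl₁x N z              ∎

refl₂x-*-isSquare : ∀ N x y z w → OnCurve N x y → OnCurve N z w → y ≢ 0ℚ → w ≢ 0ℚ →
                    IsSquare (x * z) → IsSquare (refl₂x N x * refl₂x N z)
refl₂x-*-isSquare N x y z w onX onZ y≢0 w≢0 xz-square =
  subst IsSquare regroup (isSquare-* xz-square (isSquare-square (N * s * t)))
  where
  s = y * inv x * inv (x - N)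
  t = w * inv z * inv (z - N)
  regroup : (x * z) * ((N * s * t) * (N * s * t)) ≡ refl₂x N x * refl₂x N z
  regroup = begin
    (x * z) * ((N * s * t) * (N * s * t))   ≡⟨ solve 5 (λ N x z s t → (x :* z) :* ((N :* s :* t) :* (N :* s :* t))
                                                              := (N :* x :* (s :* s)) :* (N :* z :* (t :* t))) refl N x z s t ⟩
    (N * x * (s * s)) * (N * z * (t * t))   ≡⟨ sym (cong₂ _*_ (refl₂x≡N*x*square N x y onX y≢0) (refl₂x≡N*x*square N z w onZ w≢0)) ⟩
    refl₂x N x * refl₂x N z                 ∎

mainTheorem11 : (N X Y Z W : ℚ) → N ≢ 0ℚ →
    OnCurve N X Y → OnCurve N Z W → Y ≢ 0ℚ → W ≢ 0ℚ →
    IsSquare (X * Z) →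
    IsSquare (refl₁x N X * refl₁x N Z) × IsSquare (refl₂x N X * refl₂x N Z)
mainTheorem11 N X Y Z W _ onX onZ Y≢0 W≢0 XZ-square =
  refl₁x-*-isSquare N X Z XZ-square , refl₂x-*-isSquare N X Y Z W onX onZ Y≢0 W≢0 XZ-square
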